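{- Let $X$ be a set of size $n\in\mathbb{N}$. If $f\colon X\to X$ is such that $f\circ f$ is constant, then $\operatorname{rank}(\operatorname{Partition}(f))\geq 0$. Conversely, for every partition $\lambda$ of $n$ with $\operatorname{rank}(\lambda)\geq 0$ there is a function $f\colon X\to X$ such that $f\circ f$ is constant and $\operatorname{Partition}(f)=\lambda$.
   Context: For $f\colon X\to X$, $\operatorname{Partition}(f)$ is the partition of $n$ obtained from the multiset of fiber sizes $|f^{ -1}(y)|$, $y\in X$, by ordering them nonincreasingly and omitting zeros. A partition of $n$ is a nonincreasing finite sequence $(\lambda_1,\ldots,\lambda_k)$ of positive integers with sum $n$; its rank is $\lambda_1-k$. -}

module Defs where

open import Data.Nat using (ℕ; zero; suc; _+_; _<_; _≤ᵇ_)
open import Data.Nat.Properties using (≤-totalOrder)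
open import Data.Fin using (Fin)
open import Data.Fin.Properties using (_≟_)
open import Data.List using (List; []; _∷_; length; map; filter; allFin)
open import Data.Nat.ListAction using (sum)
open import Data.List.Relation.Unary.All using (All)
open import Data.List.Relation.Unary.Sorted.TotalOrder using (Sorted)
open import Relation.Binary.Construct.Flip.EqAndOrd using () renaming (totalOrder to flipTO)
open import Data.Bool using (if_then_else_)
open import Data.Integer using (ℤ; +_; _-_)
open import Data.Product using (_×_)
open import Relation.Binary.PropositionalEquality using (_≡_)
open import Data.Nat.Properties using () renaming (_≟_ to _≟ℕ_)
open import Relation.Nullary.Decidable using (¬?)

Nonincreasing : List ℕ → Set
Nonincreasing = Sorted (flipTO ≤-totalOrder)

IsPartition : ℕ → List ℕ → Set
IsPartition n ls = Nonincreasing ls × All (λ k → 0 < k) ls × sum ls ≡ n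

rank : List ℕ → ℤ
rank []       = + 0
rank (l ∷ ls) = + l - + length (l ∷ ls)

insertDesc : ℕ → List ℕ → List ℕ
insertDesc x []       = x ∷ []
insertDesc x (y ∷ ys) = if y ≤ᵇ x then x ∷ y ∷ ys else y ∷ insertDesc x ys

sortDesc : List ℕ → List ℕ
sortDesc []       = []
sortDesc (x ∷ xs) = insertDesc x (sortDesc xs)

fiberSize : ∀ {n} → (Fin n → Fin n) → Fin n → ℕ
fiberSize {n} f y = length (filter (λ x → f x ≟ y) (allFin n))

Partition : ∀ {n} → (Fin n → Fin n) → List ℕ
Partition {n} f =
  sortDesc (filter (λ k → ¬? (k ≟ℕ 0)) (map (fiberSize f) (allFin n)))

IsConstant : ∀ {n} → (Fin n → Fin n) → Set
IsConstant {n} g = ∀ x y → g x ≡ g y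

{-# OPTIONS --safe #-}
module Submission where

-- If f ∘ f is constant with value c, then f c = c and every point of the image
-- of f lies in the fiber over c. The nonzero fibers sit over image points, so
-- there are at most |f⁻¹(c)| ≤ λ₁ of them, i.e. the rank is nonnegative.
-- Conversely, given λ = (λ₁, …, λ_k) with k ≤ λ₁, send the i-th block of λᵢ
-- consecutive points to the point i - 1. Every value lies below k ≤ λ₁, hence
-- in the first block, so f ∘ f is constantly 0 and the fibers are exactly λ.

open import Defs
open import Data.Nat as ℕ using (ℕ; zero; suc; _+_; _∸_; _<_; _≤ᵇ_; z≤n; s≤s; _≟_)
open import Data.Nat.Properties
  using (module ≤-Reasoning; ≤-refl; ≤-trans; suc-injective; ≤⇒≤ᵇ; ≤ᵇ⇒≤; ≰⇒≥; m≤n⇒m≤1+n; m≤m+n; m<n⇒n≢0; +-identityʳ)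
open import Data.Fin using (Fin; zero; toℕ; fromℕ<)
open import Data.Fin.Properties using (toℕ-fromℕ<; toℕ-injective) renaming (_≟_ to _≟ᶠ_)
open import Data.List using (List; []; _∷_; _++_; length; map; filter; replicate; tabulate; allFin)
open import Data.List.Properties
  using (length-++; length-replicate; length-map; filter-++; filter-all; ++-identityʳ;
         map-tabulate; tabulate-cong; filter-some; filter-none)
open import Data.List.Relation.Unary.All using (All; []; _∷_) renaming (map to All-map)
import Data.List.Relation.Unary.All.Properties as All
open import Data.List.Relation.Unary.Any using (here; there)
open import Data.List.Relation.Unary.Linked using (_∷_)
open import Data.List.Membership.Propositional using (_∈_; lose)
open import Data.List.Membership.Propositional.Properties using (∈-allFin; ∈-map⁺; ∈-filter⁺)
open import Data.Nat.ListAction using (sum)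
open import Data.Integer using (+_; +≤+; _≤_)
open import Data.Integer.Properties using (i≤j⇒0≤j-i; 0≤i-j⇒j≤i; drop‿+≤+)
open import Data.Bool using (true; false; T)
open import Data.Empty using (⊥-elim)
open import Data.Product using (Σ; ∃; _×_; _,_; proj₁; proj₂)
open import Function using (_∘_; id)
open import Level using (Level)
open import Relation.Nullary using (yes; no; ¬?)
open import Relation.Unary using (Pred; Decidable)
open import Relation.Binary.PropositionalEquality
  using (_≡_; _≢_; refl; sym; trans; cong; cong₂; subst; module ≡-Reasoning)

private
  variable
    a b p q : Level
    A : Set a
    B : Set b

headOr0 : List ℕ → ℕ
headOr0 []      = 0
headOr0 (x ∷ _) = x

nonzero? : Decidable {A = ℕ} (_≢ 0)
nonzero? k = ¬? (k ≟ 0)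

count : ℕ → List ℕ → ℕ
count m xs = length (filter (_≟ m) xs)

nthOr0 : List ℕ → ℕ → ℕ
nthOr0 []       _       = 0
nthOr0 (x ∷ _)  zero    = x
nthOr0 (_ ∷ xs) (suc m) = nthOr0 xs m

length≤head⇒0≤rank : ∀ xs → length xs ℕ.≤ headOr0 xs → + 0 ≤ rank xs
length≤head⇒0≤rank []      _   = +≤+ z≤n
length≤head⇒0≤rank (_ ∷ _) k≤l = i≤j⇒0≤j-i (+≤+ k≤l)

0≤rank⇒length≤head : ∀ xs → + 0 ≤ rank xs → length xs ℕ.≤ headOr0 xs
0≤rank⇒length≤head []      _   = z≤n
0≤rank⇒length≤head (_ ∷ _) 0≤r = drop‿+≤+ (0≤i-j⇒j≤i 0≤r)

headOr0-insertDesc : ∀ x ys →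
  x ℕ.≤ headOr0 (insertDesc x ys) × headOr0 ys ℕ.≤ headOr0 (insertDesc x ys)
headOr0-insertDesc x []       = ≤-refl , z≤n
headOr0-insertDesc x (y ∷ ys) with y ≤ᵇ x in y≤ᵇx
... | true  = ≤-refl , ≤ᵇ⇒≤ y x (subst T (sym y≤ᵇx) _)
... | false = ≰⇒≥ (λ y≤x → subst T y≤ᵇx (≤⇒≤ᵇ y≤x)) , ≤-refl

∈⇒≤-headOr0-sortDesc : ∀ {x} xs → x ∈ xs → x ℕ.≤ headOr0 (sortDesc xs)
∈⇒≤-headOr0-sortDesc (y ∷ ys) (here refl) = proj₁ (headOr0-insertDesc y (sortDesc ys))
∈⇒≤-headOr0-sortDesc (y ∷ ys) (there x∈ys) =
  ≤-trans (∈⇒≤-headOr0-sortDesc ys x∈ys) (proj₂ (headOr0-insertDesc y (sortDesc ys)))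

length-insertDesc : ∀ x ys → length (insertDesc x ys) ≡ suc (length ys)
length-insertDesc x []       = refl
length-insertDesc x (y ∷ ys) with y ≤ᵇ x
... | true  = refl
... | false = cong suc (length-insertDesc x ys)

length-sortDesc : ∀ xs → length (sortDesc xs) ≡ length xs
length-sortDesc []       = refl
length-sortDesc (x ∷ xs) = trans (length-insertDesc x (sortDesc xs)) (cong suc (length-sortDesc xs))

sortDesc-nonincreasing : ∀ xs → Nonincreasing xs → sortDesc xs ≡ xs
sortDesc-nonincreasing []           _         = refl
sortDesc-nonincreasing (x ∷ [])     _         = refl
sortDesc-nonincreasing (x ∷ y ∷ ys) (y≤x ∷ s) rewrite sortDesc-nonincreasing (y ∷ ys) s
  with y ≤ᵇ x | ≤⇒≤ᵇ y≤x
... | true | _ = refl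

module _ {P : Pred A p} (P? : Decidable P) where

  length-filter≢0⇒∃ : ∀ xs → length (filter P? xs) ≢ 0 → ∃ P
  length-filter≢0⇒∃ []       ≢0 = ⊥-elim (≢0 refl)
  length-filter≢0⇒∃ (x ∷ xs) ≢0 with P? x
  ... | yes px = x , px
  ... | no  _  = length-filter≢0⇒∃ xs ≢0

module _ (g : A → B) {P : Pred B p} {Q : Pred A q} (P? : Decidable P) (Q? : Decidable Q) where

  length-filter-map-≤ : (∀ x → P (g x) → Q x) →
    ∀ xs → length (filter P? (map g xs)) ℕ.≤ length (filter Q? xs)
  length-filter-map-≤ P⇒Q []       = z≤n
  length-filter-map-≤ P⇒Q (x ∷ xs) with P? (g x) | Q? x
  ... | yes _  | yes _ = s≤s (length-filter-map-≤ P⇒Q xs)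
  ... | yes px | no ¬q = ⊥-elim (¬q (P⇒Q x px))
  ... | no  _  | yes _ = m≤n⇒m≤1+n (length-filter-map-≤ P⇒Q xs)
  ... | no  _  | no  _ = length-filter-map-≤ P⇒Q xs

  length-filter-map : (∀ x → P (g x) → Q x) → (∀ x → Q x → P (g x)) →
    ∀ xs → length (filter P? (map g xs)) ≡ length (filter Q? xs)
  length-filter-map P⇒Q Q⇒P []       = refl
  length-filter-map P⇒Q Q⇒P (x ∷ xs) with P? (g x) | Q? x
  ... | yes _  | yes _ = cong suc (length-filter-map P⇒Q Q⇒P xs)
  ... | yes px | no ¬q = ⊥-elim (¬q (P⇒Q x px))
  ... | no ¬p  | yes q = ⊥-elim (¬p (Q⇒P x q))
  ... | no  _  | no  _ = length-filter-map P⇒Q Q⇒P xs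

module _ {n} (f : Fin n → Fin n) where

  fiberSize≢0⇒∈image : ∀ y → fiberSize f y ≢ 0 → ∃ λ x → f x ≡ y
  fiberSize≢0⇒∈image y = length-filter≢0⇒∃ (λ x → f x ≟ᶠ y) (allFin n)

  fiberSize-fixedPoint≢0 : ∀ {c} → f c ≡ c → fiberSize f c ≢ 0
  fiberSize-fixedPoint≢0 {c} fc≡c =
    m<n⇒n≢0 (filter-some (λ x → f x ≟ᶠ c) (lose (∈-allFin c) fc≡c))

  module _ (c : Fin n) (f∘f≡c : ∀ x → f (f x) ≡ c) where

    length-nonzeroFibers≤fiberSize :
      length (filter nonzero? (map (fiberSize f) (allFin n))) ℕ.≤ fiberSize f c
    length-nonzeroFibers≤fiberSize =
      length-filter-map-≤ (fiberSize f) nonzero? (λ y → f y ≟ᶠ c) image⇒c (allFin n)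
      where
      image⇒c : ∀ y → fiberSize f y ≢ 0 → f y ≡ c
      image⇒c y ≢0 with x , refl ← fiberSize≢0⇒∈image y ≢0 = f∘f≡c x

    0≤rank-Partition : f c ≡ c → + 0 ≤ rank (Partition f)
    0≤rank-Partition fc≡c = length≤head⇒0≤rank (sortDesc fibers) (begin
        length (sortDesc fibers)  ≡⟨ length-sortDesc fibers ⟩
        length fibers             ≤⟨ length-nonzeroFibers≤fiberSize ⟩
        fiberSize f c             ≤⟨ ∈⇒≤-headOr0-sortDesc fibers c∈fibers ⟩
        headOr0 (sortDesc fibers) ∎)
      where
      open ≤-Reasoning
      fibers : List ℕ
      fibers = filter nonzero? (map (fiberSize f) (allFin n))
      c∈fibers : fiberSize f c ∈ fibers
      c∈fibers = ∈-filter⁺ nonzero? (∈-map⁺ (fiberSize f) (∈-allFin c)) (fiberSize-fixedPoint≢0 fc≡c)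

constantSquare⇒0≤rank : ∀ n (f : Fin n → Fin n) → IsConstant (f ∘ f) → + 0 ≤ rank (Partition f)
constantSquare⇒0≤rank zero    f _        = +≤+ z≤n
constantSquare⇒0≤rank (suc n) f constant =
  0≤rank-Partition f (f (f zero)) (λ x → constant x zero) (constant (f zero) zero)

tabulate-const : ∀ n (x : A) → tabulate {n = n} (λ _ → x) ≡ replicate n x
tabulate-const zero    x = refl
tabulate-const (suc n) x = cong (x ∷_) (tabulate-const n x)

tabulate-nthOr0 : ∀ {n} xs → length xs ≡ n → tabulate {n = n} (nthOr0 xs ∘ toℕ) ≡ xs
tabulate-nthOr0 []       refl = refl
tabulate-nthOr0 (x ∷ xs) refl = cong (x ∷_) (tabulate-nthOr0 xs refl)

nthOr0-All : ∀ {P : Pred ℕ p} {xs} → All P xs → P 0 → ∀ m → P (nthOr0 xs m)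
nthOr0-All []        p0 m       = p0
nthOr0-All (px ∷ _)  p0 zero    = px
nthOr0-All (_ ∷ pxs) p0 (suc m) = nthOr0-All pxs p0 m

nthOr0-replicate-++ : ∀ l xs {m} → m < l → nthOr0 (replicate l 0 ++ xs) m ≡ 0
nthOr0-replicate-++ (suc l) xs {zero}  _         = refl
nthOr0-replicate-++ (suc l) xs {suc m} (s≤s m<l) = nthOr0-replicate-++ l xs m<l

count-++ : ∀ m xs ys → count m (xs ++ ys) ≡ count m xs + count m ys
count-++ m xs ys = trans (cong length (filter-++ (_≟ m) xs ys)) (length-++ (filter (_≟ m) xs))

count-zero-replicate : ∀ l → count 0 (replicate l 0) ≡ l
count-zero-replicate zero    = refl
count-zero-replicate (suc l) = cong suc (count-zero-replicate l)

count-suc-replicate : ∀ m l → count (suc m) (replicate l 0) ≡ 0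
count-suc-replicate m zero    = refl
count-suc-replicate m (suc l) = count-suc-replicate m l

count-zero-map-suc : ∀ xs → count 0 (map suc xs) ≡ 0
count-zero-map-suc []       = refl
count-zero-map-suc (x ∷ xs) = count-zero-map-suc xs

count-suc-map-suc : ∀ m xs → count (suc m) (map suc xs) ≡ count m xs
count-suc-map-suc m = length-filter-map suc (_≟ suc m) (_≟ m) (λ _ → suc-injective) (λ _ → cong suc)

blockLabels : List ℕ → List ℕ
blockLabels []       = []
blockLabels (l ∷ ls) = replicate l 0 ++ map suc (blockLabels ls)

length-blockLabels : ∀ ls → length (blockLabels ls) ≡ sum ls
length-blockLabels []       = refl
length-blockLabels (l ∷ ls) = begin
  length (replicate l 0 ++ map suc (blockLabels ls))
    ≡⟨ length-++ (replicate l 0) ⟩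
  length (replicate l 0) + length (map suc (blockLabels ls))
    ≡⟨ cong₂ _+_ (length-replicate l) (length-map suc (blockLabels ls)) ⟩
  l + length (blockLabels ls)
    ≡⟨ cong (λ s → l + s) (length-blockLabels ls) ⟩
  l + sum ls ∎
  where open ≡-Reasoning

blockLabels<length : ∀ ls → All (_< length ls) (blockLabels ls)
blockLabels<length []       = []
blockLabels<length (l ∷ ls) =
  All.++⁺ (All.replicate⁺ l (s≤s z≤n)) (All.map⁺ (All-map s≤s (blockLabels<length ls)))

count-zero-blockLabels : ∀ l ls → count 0 (blockLabels (l ∷ ls)) ≡ l
count-zero-blockLabels l ls = begin
  count 0 (replicate l 0 ++ map suc (blockLabels ls))
    ≡⟨ count-++ 0 (replicate l 0) _ ⟩
  count 0 (replicate l 0) + count 0 (map suc (blockLabels ls))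
    ≡⟨ cong₂ _+_ (count-zero-replicate l) (count-zero-map-suc (blockLabels ls)) ⟩
  l + 0
    ≡⟨ +-identityʳ l ⟩
  l ∎
  where open ≡-Reasoning

count-suc-blockLabels : ∀ m l ls → count (suc m) (blockLabels (l ∷ ls)) ≡ count m (blockLabels ls)
count-suc-blockLabels m l ls = begin
  count (suc m) (replicate l 0 ++ map suc (blockLabels ls))
    ≡⟨ count-++ (suc m) (replicate l 0) _ ⟩
  count (suc m) (replicate l 0) + count (suc m) (map suc (blockLabels ls))
    ≡⟨ cong₂ _+_ (count-suc-replicate m l) (count-suc-map-suc m (blockLabels ls)) ⟩
  count m (blockLabels ls) ∎
  where open ≡-Reasoning

tabulate-count-blockLabels : ∀ {j} ls → length ls ℕ.≤ j →
  tabulate {n = j} (λ i → count (toℕ i) (blockLabels ls)) ≡ ls ++ replicate (j ∸ length ls) 0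
tabulate-count-blockLabels {j}     []       _         = tabulate-const j 0
tabulate-count-blockLabels {suc j} (l ∷ ls) (s≤s k≤j) = cong₂ _∷_
  (count-zero-blockLabels l ls)
  (trans (tabulate-cong (λ i → count-suc-blockLabels (toℕ i) l ls)) (tabulate-count-blockLabels ls k≤j))

sortDesc-filter-nonzero : ∀ ls r → Nonincreasing ls → All (0 <_) ls →
  sortDesc (filter nonzero? (ls ++ replicate r 0)) ≡ ls
sortDesc-filter-nonzero ls r nonincreasing positive = begin
  sortDesc (filter nonzero? (ls ++ replicate r 0))
    ≡⟨ cong sortDesc (filter-++ nonzero? ls (replicate r 0)) ⟩
  sortDesc (filter nonzero? ls ++ filter nonzero? (replicate r 0))
    ≡⟨ cong₂ (λ xs ys → sortDesc (xs ++ ys))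
         (filter-all nonzero? (All-map m<n⇒n≢0 positive))
         (filter-none nonzero? (All.replicate⁺ r (λ 0≢0 → 0≢0 refl))) ⟩
  sortDesc (ls ++ [])
    ≡⟨ cong sortDesc (++-identityʳ ls) ⟩
  sortDesc ls
    ≡⟨ sortDesc-nonincreasing ls nonincreasing ⟩
  ls ∎
  where open ≡-Reasoning

module BlockMap (l : ℕ) (ls : List ℕ) (k≤l : length (l ∷ ls) ℕ.≤ l) where

  n : ℕ
  n = sum (l ∷ ls)

  labels : List ℕ
  labels = blockLabels (l ∷ ls)

  label<k : ∀ m → nthOr0 labels m < length (l ∷ ls)
  label<k = nthOr0-All (blockLabels<length (l ∷ ls)) (s≤s z≤n)

  k≤n : length (l ∷ ls) ℕ.≤ n
  k≤n = ≤-trans k≤l (m≤m+n l (sum ls))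

  blockMap : Fin n → Fin n
  blockMap x = fromℕ< (≤-trans (label<k (toℕ x)) k≤n)

  toℕ-blockMap : ∀ x → toℕ (blockMap x) ≡ nthOr0 labels (toℕ x)
  toℕ-blockMap x = toℕ-fromℕ< _

  -- Every label is below k ≤ l, and the first l labels are 0.
  toℕ-blockMap² : ∀ x → toℕ (blockMap (blockMap x)) ≡ 0
  toℕ-blockMap² x = begin
    toℕ (blockMap (blockMap x))            ≡⟨ toℕ-blockMap (blockMap x) ⟩
    nthOr0 labels (toℕ (blockMap x))       ≡⟨ cong (nthOr0 labels) (toℕ-blockMap x) ⟩
    nthOr0 labels (nthOr0 labels (toℕ x))  ≡⟨ nthOr0-replicate-++ l _ (≤-trans (label<k (toℕ x)) k≤l) ⟩
    0                                      ∎
    where open ≡-Reasoning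

  blockMap²-constant : IsConstant (blockMap ∘ blockMap)
  blockMap²-constant x y = toℕ-injective (trans (toℕ-blockMap² x) (sym (toℕ-blockMap² y)))

  map-toℕ-blockMap : map (toℕ ∘ blockMap) (allFin n) ≡ labels
  map-toℕ-blockMap = begin
    map (toℕ ∘ blockMap) (allFin n)  ≡⟨ map-tabulate id (toℕ ∘ blockMap) ⟩
    tabulate (toℕ ∘ blockMap)        ≡⟨ tabulate-cong toℕ-blockMap ⟩
    tabulate (nthOr0 labels ∘ toℕ)   ≡⟨ tabulate-nthOr0 labels (length-blockLabels (l ∷ ls)) ⟩
    labels                           ∎
    where open ≡-Reasoning

  fiberSize-blockMap : ∀ y → fiberSize blockMap y ≡ count (toℕ y) labels
  fiberSize-blockMap y = begin
    fiberSize blockMap y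
      ≡⟨ length-filter-map (toℕ ∘ blockMap) (_≟ toℕ y) (λ x → blockMap x ≟ᶠ y)
           (λ _ → toℕ-injective) (λ _ → cong toℕ) (allFin n) ⟨
    count (toℕ y) (map (toℕ ∘ blockMap) (allFin n))
      ≡⟨ cong (count (toℕ y)) map-toℕ-blockMap ⟩
    count (toℕ y) labels ∎
    where open ≡-Reasoning

  fiberSizes-blockMap : map (fiberSize blockMap) (allFin n) ≡ (l ∷ ls) ++ replicate (n ∸ length (l ∷ ls)) 0
  fiberSizes-blockMap = begin
    map (fiberSize blockMap) (allFin n)            ≡⟨ map-tabulate id (fiberSize blockMap) ⟩
    tabulate (fiberSize blockMap)                  ≡⟨ tabulate-cong fiberSize-blockMap ⟩
    tabulate (λ y → count (toℕ y) labels)          ≡⟨ tabulate-count-blockLabels (l ∷ ls) k≤n ⟩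
    (l ∷ ls) ++ replicate (n ∸ length (l ∷ ls)) 0  ∎
    where open ≡-Reasoning

  Partition-blockMap : Nonincreasing (l ∷ ls) → All (0 <_) (l ∷ ls) → Partition blockMap ≡ l ∷ ls
  Partition-blockMap nonincreasing positive =
    trans (cong (sortDesc ∘ filter nonzero?) fiberSizes-blockMap)
          (sortDesc-filter-nonzero (l ∷ ls) _ nonincreasing positive)

realise-partition : ∀ n ls → IsPartition n ls → + 0 ≤ rank ls →
  Σ (Fin n → Fin n) (λ f → IsConstant (f ∘ f) × Partition f ≡ ls)
realise-partition _ []       (_ , _ , refl) _ = (λ ()) , (λ ()) , refl
realise-partition _ (l ∷ ls) (nonincreasing , positive , refl) 0≤rank =
  blockMap , blockMap²-constant , Partition-blockMap nonincreasing positive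
  where open BlockMap l ls (0≤rank⇒length≤head (l ∷ ls) 0≤rank)

lemma9 : (n : ℕ)
    → ((f : Fin n → Fin n) → IsConstant (f ∘ f) → + 0 ≤ rank (Partition f))
    × ((ls : List ℕ) → IsPartition n ls → + 0 ≤ rank ls
        → Σ (Fin n → Fin n) (λ f → IsConstant (f ∘ f) × Partition f ≡ ls))
lemma9 n = constantSquare⇒0≤rank n , realise-partition n
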